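{- Let $H$ be a Kekul\'ean hexagonal system and $n\ge 0$ an integer. For every Clar cover $C$ of $H$ with exactly $n$ hexagons, the subgraph $f(C)$ of $R(H)$ is an induced subgraph of $R(H)$ isomorphic to the $n$-cube $Q_n$.
   Context: A hexagonal system is a 2-connected finite plane graph in which every interior face is a regular hexagon of side length one; its hexagons are the boundaries of its interior faces. $H$ is Kekul\'ean if it has a perfect matching. A Clar cover of $H$ is a spanning subgraph of $H$ each of whose connected components is either a hexagon of $H$ or a single edge. The resonance graph $R(H)$ has the perfect matchings of $H$ as vertices, two perfect matchings $M,M'$ being adjacent iff $M\oplus M'$ (symmetric difference) is the edge set of a hexagon of $H$. For a perfect matching $M$, a cycle is $M$-alternating if its edges alternately belong and do not belong to $M$. For a Clar cover $C$, $f(C)$ is defined as the subgraph of $R(H)$ induced by all perfect matchings $M$ of $H$ such that every hexagon of $C$ is $M$-alternating and every single-edge component of $C$ belongs to $M$. $Q_n$ is the graph on binary strings of length $n$, two being adjacent iff they differ in exactly one position. -}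

module Defs where

open import Data.Bool using (Bool; true; false; _xor_)
open import Data.Integer using (ℤ; _+_; _*_; +_; _>_)
open import Data.Nat using (ℕ)
open import Data.Product using (_×_; _,_; Σ; ∃; proj₁; proj₂)
open import Data.Sum using (_⊎_)
open import Data.Fin using (Fin)
open import Data.List using (List; []; _∷_; length; map; _++_; lookup)
open import Data.List.Relation.Unary.All using (All)
open import Data.List.Membership.Propositional using (_∈_; _∉_)
open import Data.Vec using (Vec)
import Data.Vec as V
open import Relation.Binary.PropositionalEquality using (_≡_; _≢_)
open import Function.Bundles using (_⇔_)

-- The hexagonal (honeycomb) lattice, in "brick-wall" coordinates.  Lattice edges are
--   hor x y : {(x,y),(x+1,y)}                 (all x, y)
--   ver x y : {(x,y),(x,y+1)}                 (only for x + y even)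
-- Each edge has a unique name.

Vertex : Set
Vertex = ℤ × ℤ

data Edge : Set where
  hor : ℤ → ℤ → Edge
  ver : ℤ → ℤ → Edge

ends : Edge → Vertex × Vertex
ends (hor x y) = (x , y) , (x + + 1 , y)
ends (ver x y) = (x , y) , (x , y + + 1)

_∈ᵉ_ : Vertex → Edge → Set
v ∈ᵉ e = (v ≡ proj₁ (ends e)) ⊎ (v ≡ proj₂ (ends e))

Hex : Set
Hex = ℤ × ℤ

corner : Hex → Vertex
corner (i , j) = (+ 2 * i + j , j)

-- the six edges of a hexagon, in cyclic order around its boundary
hexEdges : Hex → List Edge
hexEdges h with corner h
... | (x , y) = hor x y ∷ hor (x + + 1) y ∷ ver (x + + 2) y
              ∷ hor (x + + 1) (y + + 1) ∷ hor x (y + + 1) ∷ ver x y ∷ []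

hexVerts : Hex → List Vertex
hexVerts h with corner h
... | (x , y) = (x , y) ∷ (x + + 1 , y) ∷ (x + + 2 , y)
              ∷ (x , y + + 1) ∷ (x + + 1 , y + + 1) ∷ (x + + 2 , y + + 1) ∷ []

hexNbrs : Hex → List Hex
hexNbrs (i , j) = (i + + 1 , j) ∷ (i + Data.Integer.-[1+ 0 ] , j)
                ∷ (i , j + + 1) ∷ (i , j + Data.Integer.-[1+ 0 ])
                ∷ (i + + 1 , j + Data.Integer.-[1+ 0 ]) ∷ (i + Data.Integer.-[1+ 0 ] , j + + 1) ∷ []

Adj : Hex → Hex → Set
Adj h k = k ∈ hexNbrs h

data Reach (P : Hex → Set) : Hex → Hex → Set where
  here : ∀ {h} → P h → Reach P h h
  step : ∀ {h k h'} → P h → Adj h k → Reach P k h' → Reach P h h'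

-- Hexagonal systems: a finite nonempty set of lattice hexagons (the
-- hexagons = interior faces of H) which is connected (via shared edges)
-- and has no holes (every lattice hexagon not in the set can escape,
-- avoiding the set, to a row above all hexagons of the set).  The graph
-- H is the union of the boundaries of these hexagons.

record HexSystem : Set where
  field
    hexes    : List Hex
    nonempty : ∃ λ h → h ∈ hexes
    connected : ∀ {h k} → h ∈ hexes → k ∈ hexes → Reach (_∈ hexes) h k
    noHoles  : ∀ h → h ∉ hexes →
               ∃ λ k → Reach (_∉ hexes) h k × All (λ g → proj₂ k > proj₂ g) hexes
open HexSystem public

IsHex : HexSystem → Hex → Set
IsHex H h = h ∈ hexes H

IsVertex : HexSystem → Vertex → Set
IsVertex H v = ∃ λ h → IsHex H h × v ∈ hexVerts h

IsEdge : HexSystem → Edge → Set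
IsEdge H e = ∃ λ h → IsHex H h × e ∈ hexEdges h

EdgeSet : Set
EdgeSet = Edge → Bool

record PerfectMatching (H : HexSystem) (M : EdgeSet) : Set where
  field
    inH    : ∀ e → M e ≡ true → IsEdge H e
    unique : ∀ v → IsVertex H v →
             ∃ λ e → M e ≡ true × v ∈ᵉ e ×
               (∀ e' → M e' ≡ true → v ∈ᵉ e' → e' ≡ e)

Kekulean : HexSystem → Set
Kekulean H = ∃ λ M → PerfectMatching H M

-- equality of edge sets (vertices of R(H) are edge sets)
_≈ₘ_ : EdgeSet → EdgeSet → Set
M ≈ₘ M' = ∀ e → M e ≡ M' e

-- adjacency in the resonance graph R(H): M ⊕ M' is the edge set of a
-- hexagon of H
ResAdj : HexSystem → EdgeSet → EdgeSet → Set
ResAdj H M M' = ∃ λ h → IsHex H h × (∀ e → (M e xor M' e ≡ true) ⇔ (e ∈ hexEdges h))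

Alternating : EdgeSet → Hex → Set
Alternating M h =
    (map M (hexEdges h) ≡ true ∷ false ∷ true ∷ false ∷ true ∷ false ∷ [])
  ⊎ (map M (hexEdges h) ≡ false ∷ true ∷ false ∷ true ∷ false ∷ true ∷ [])

-- Clar covers: a spanning subgraph whose components are hexagons of H
-- and single edges of H, i.e. a family of hexagons and edges of H whose
-- vertex sets partition V(H).

data Piece : Set where
  hexP  : Hex → Piece
  edgeP : Edge → Piece

_∈ᵖ_ : Vertex → Piece → Set
v ∈ᵖ hexP h  = v ∈ hexVerts h
v ∈ᵖ edgeP e = v ∈ᵉ e

record ClarCover (H : HexSystem) : Set where
  field
    cHexes : List Hex
    cEdges : List Edge
    hexesInH : All (IsHex H) cHexes
    edgesInH : All (IsEdge H) cEdges
  pieces : List Piece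
  pieces = map hexP cHexes ++ map edgeP cEdges
  field
    partition : ∀ v → IsVertex H v →
      ∃ λ (i : Fin (length pieces)) → v ∈ᵖ lookup pieces i ×
        (∀ j → v ∈ᵖ lookup pieces j → j ≡ i)
open ClarCover public

-- vertex set of f(C)
InF : (H : HexSystem) → ClarCover H → EdgeSet → Set
InF H C M = PerfectMatching H M × All (Alternating M) (cHexes C)
          × All (λ e → M e ≡ true) (cEdges C)

QAdj : ∀ {n} → Vec Bool n → Vec Bool n → Set
QAdj {n} b b' = ∃ λ (i : Fin n) → V.lookup b i ≢ V.lookup b' i ×
                  (∀ j → j ≢ i → V.lookup b j ≡ V.lookup b' j)

-- f(C), the subgraph of R(H) induced by the vertices satisfying InF H C,
-- is isomorphic to Q_n: a bijection φ from V(Q_n) onto V(f(C)) (up to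
-- equality of edge sets) preserving and reflecting adjacency.
FIsoQ : (H : HexSystem) → ClarCover H → ℕ → Set
FIsoQ H C n = Σ (Vec Bool n → EdgeSet) λ φ →
    (∀ b → InF H C (φ b))
  × (∀ b b' → φ b ≈ₘ φ b' → b ≡ b')
  × (∀ M → InF H C M → ∃ λ b → φ b ≈ₘ M)
  × (∀ b b' → QAdj b b' ⇔ ResAdj H (φ b) (φ b'))

-- For a Clar cover C with hexagons h₁, …, hₙ, a bit vector b selects for every hᵢ one of
-- its two Kekulé structures (three alternate edges); together with the single edges of C
-- these form a perfect matching, because the pieces of C partition the vertices of H.
-- Every matching of f(C) arises this way, its i-th bit being read off from a fixed edge
-- of hᵢ, so b ↦ M_b is a bijection from Qₙ onto f(C). The matchings M_b and M_b' differ
-- exactly on the hexagons hᵢ with bᵢ ≠ b'ᵢ; since a lattice hexagon is determined by its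
-- edge set, M_b ⊕ M_b' is the edge set of a hexagon iff b and b' differ in one bit.
-- The local facts about a hexagon are decided by evaluation on the hexagon at the origin
-- and transported to an arbitrary hexagon by translation.

module Submission where

open import Defs
open import Data.Bool using (Bool; true; false; not; _xor_)
import Data.Bool as Bool
open import Data.Bool.Properties using (⇔→≡; xor-same; not-distribˡ-xor; not-distribʳ-xor)
open import Data.Empty using (⊥; ⊥-elim)
open import Data.Fin using (Fin; zero; suc)
import Data.Fin.Properties as Fin
open import Data.Integer using (ℤ; _+_; +_; _*_)
import Data.Integer as ℤ
open import Data.Integer.Properties using (+-identityʳ; +-assoc; +-0-abelianGroup)
open import Algebra.Properties.AbelianGroup +-0-abelianGroup using (∙-cancelˡ)
open import Data.List using (List; []; _∷_; map; length; lookup; _++_)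
open import Data.List.Properties using (map-∘; map-cong; map-cong-local; ∷-injectiveˡ; ∷-injectiveʳ)
open import Data.List.Membership.Propositional using (_∈_; _∉_)
open import Data.List.Membership.Propositional.Properties
  using (∈-map⁺; ∈-map⁻; ∈-++⁺ˡ; ∈-++⁺ʳ; ∈-++⁻; ∈-lookup)
import Data.List.Membership.DecPropositional as DecMembership
open import Data.List.Relation.Unary.All as All using (All; all?)
open import Data.List.Relation.Unary.Any as Any using (here; there)
open import Data.List.Relation.Unary.Any.Properties using (lookup-index)
open import Data.Nat using (ℕ; suc)
open import Data.Product using (∃; _×_; _,_; proj₁; proj₂; uncurry)
import Data.Product as Product
open import Data.Product.Properties using (,-injectiveˡ; ,-injectiveʳ) renaming (≡-dec to ×-≡-dec)
open import Data.Sum using (_⊎_; inj₁; inj₂)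
import Data.Sum as Sum
open import Data.Vec using (Vec; []; _∷_)
import Data.Vec as Vec
import Data.Vec.Properties as Vec
open import Function using (_∘_; id; case_of_)
open import Function.Bundles using (_⇔_; mk⇔; Equivalence)
open import Relation.Binary.Definitions using (DecidableEquality; Decidable)
open import Relation.Binary.PropositionalEquality
open import Relation.Nullary using (Dec; yes; no)
open import Relation.Nullary.Decidable using (does; dec-true; does-⇔; from-yes; map′; _×-dec_; _⊎-dec_)

_≟ᵛ_ : DecidableEquality Vertex
_≟ᵛ_ = ×-≡-dec ℤ._≟_ ℤ._≟_

_≟ᵉ_ : DecidableEquality Edge
hor x y ≟ᵉ hor x' y' = map′ (uncurry (cong₂ hor)) (λ { refl → refl , refl }) ((x ℤ.≟ x') ×-dec (y ℤ.≟ y'))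
ver x y ≟ᵉ ver x' y' = map′ (uncurry (cong₂ ver)) (λ { refl → refl , refl }) ((x ℤ.≟ x') ×-dec (y ℤ.≟ y'))
hor _ _ ≟ᵉ ver _ _   = no λ ()
ver _ _ ≟ᵉ hor _ _   = no λ ()

_∈ᵉ?_ : Decidable _∈ᵉ_
v ∈ᵉ? e = (v ≟ᵛ proj₁ (ends e)) ⊎-dec (v ≟ᵛ proj₂ (ends e))

BothEnds : (Vertex → Set) → Edge → Set
BothEnds P e = P (proj₁ (ends e)) × P (proj₂ (ends e))

bothEnds? : ∀ {P} → (∀ v → Dec (P v)) → ∀ e → Dec (BothEnds P e)
bothEnds? P? e = P? (proj₁ (ends e)) ×-dec P? (proj₂ (ends e))

BothEnds-∈ᵉ : ∀ {P e v} → BothEnds P e → v ∈ᵉ e → P v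
BothEnds-∈ᵉ (P₁ , _) (inj₁ refl) = P₁
BothEnds-∈ᵉ (_ , P₂) (inj₂ refl) = P₂

open DecMembership _≟ᵉ_ using (_∈?_)
open DecMembership _≟ᵛ_ using () renaming (_∈?_ to _∈ᵛ?_)

⟦_⟧ : List Edge → EdgeSet
⟦ es ⟧ e = does (e ∈? es)

∈⇒⟦⟧ : ∀ {e es} → e ∈ es → ⟦ es ⟧ e ≡ true
∈⇒⟦⟧ {e} {es} = dec-true (e ∈? es)

⟦⟧⇒∈ : ∀ {e es} → ⟦ es ⟧ e ≡ true → e ∈ es
⟦⟧⇒∈ {e} {es} _ with e ∈? es
⟦⟧⇒∈ {e} {es} _  | yes e∈es = e∈es
⟦⟧⇒∈ {e} {es} () | no _

⟦⟧-cong : ∀ {e e' es es'} → e ∈ es ⇔ e' ∈ es' → ⟦ es ⟧ e ≡ ⟦ es' ⟧ e'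
⟦⟧-cong {e} {e'} {es} {es'} iff = does-⇔ iff (e ∈? es) (e' ∈? es')

≡-on-map : ∀ {A B : Set} {f g : A → B} {xs x} → map f xs ≡ map g xs → x ∈ xs → f x ≡ g x
≡-on-map {xs = _ ∷ _} eq (here refl) = ∷-injectiveˡ eq
≡-on-map {xs = _ ∷ _} eq (there m)   = ≡-on-map (∷-injectiveʳ eq) m

xor≡true⇔≢ : ∀ a b → (a xor b ≡ true) ⇔ (a ≢ b)
xor≡true⇔≢ false false = mk⇔ (λ ())   (λ a≢b → ⊥-elim (a≢b refl))
xor≡true⇔≢ false true  = mk⇔ (λ _ ()) (λ _ → refl)
xor≡true⇔≢ true  false = mk⇔ (λ _ ()) (λ _ → refl)
xor≡true⇔≢ true  true  = mk⇔ (λ ())   (λ a≢b → ⊥-elim (a≢b refl))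

x+[1+n]≢x : ∀ x n → x + + suc n ≢ x
x+[1+n]≢x x n eq with ∙-cancelˡ x (+ suc n) (+ 0) (trans eq (sym (+-identityʳ x)))
... | ()

module _ {A B : Set} (f : A → B) where

  position : ∀ xs (ys : List B) → Fin (length xs) → Fin (length (map f xs ++ ys))
  position (x ∷ xs) ys zero    = zero
  position (x ∷ xs) ys (suc i) = suc (position xs ys i)

  lookup-position : ∀ xs ys i → lookup (map f xs ++ ys) (position xs ys i) ≡ f (lookup xs i)
  lookup-position (x ∷ xs) ys zero    = refl
  lookup-position (x ∷ xs) ys (suc i) = lookup-position xs ys i

  position-injective : ∀ xs ys {i j} → position xs ys i ≡ position xs ys j → i ≡ j
  position-injective (x ∷ xs) ys {zero}  {zero}  _  = refl
  position-injective (x ∷ xs) ys {suc i} {suc j} eq = cong suc (position-injective xs ys (Fin.suc-injective eq))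
  position-injective (x ∷ xs) ys {zero}  {suc j} ()
  position-injective (x ∷ xs) ys {suc i} {zero}  ()

infixl 25 _⊕_

_⊕_ : Vertex → Vertex → Vertex
(x , y) ⊕ (a , b) = (x + a , y + b)

⊕-cancelˡ : ∀ c {u u'} → c ⊕ u ≡ c ⊕ u' → u ≡ u'
⊕-cancelˡ (x , y) {a , b} {a' , b'} eq =
  cong₂ _,_ (∙-cancelˡ x a a' (,-injectiveˡ eq)) (∙-cancelˡ y b b' (,-injectiveʳ eq))

shift : Vertex → Edge → Edge
shift (x , y) (hor a b) = hor (x + a) (y + b)
shift (x , y) (ver a b) = ver (x + a) (y + b)

shift-injective : ∀ c {e e'} → shift c e ≡ shift c e' → e ≡ e'
shift-injective (x , y) {hor _ _} {hor _ _} eq = cong (uncurry hor) (⊕-cancelˡ (x , y) (cong (proj₁ ∘ ends) eq))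
shift-injective (x , y) {ver _ _} {ver _ _} eq = cong (uncurry ver) (⊕-cancelˡ (x , y) (cong (proj₁ ∘ ends) eq))
shift-injective c {hor _ _} {ver _ _} ()
shift-injective c {ver _ _} {hor _ _} ()

ends-shift : ∀ c e → ends (shift c e) ≡ (c ⊕ proj₁ (ends e) , c ⊕ proj₂ (ends e))
ends-shift (x , y) (hor a b) = cong (λ z → (x + a , y + b) , (z , y + b)) (+-assoc x a (+ 1))
ends-shift (x , y) (ver a b) = cong (λ z → (x + a , y + b) , (x + a , z)) (+-assoc y b (+ 1))

∈ᵉ-shift⁺ : ∀ c e {u} → u ∈ᵉ e → c ⊕ u ∈ᵉ shift c e
∈ᵉ-shift⁺ c e (inj₁ refl) = inj₁ (sym (cong proj₁ (ends-shift c e)))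
∈ᵉ-shift⁺ c e (inj₂ refl) = inj₂ (sym (cong proj₂ (ends-shift c e)))

∈ᵉ-shift⁻ : ∀ c e {v} → v ∈ᵉ shift c e → ∃ λ u → v ≡ c ⊕ u × u ∈ᵉ e
∈ᵉ-shift⁻ c e (inj₁ eq) = proj₁ (ends e) , trans eq (cong proj₁ (ends-shift c e)) , inj₁ refl
∈ᵉ-shift⁻ c e (inj₂ eq) = proj₂ (ends e) , trans eq (cong proj₂ (ends-shift c e)) , inj₂ refl

⟦⟧-shift : ∀ c es e → ⟦ map (shift c) es ⟧ (shift c e) ≡ ⟦ es ⟧ e
⟦⟧-shift c es e = ⟦⟧-cong (mk⇔ from (∈-map⁺ (shift c)))
  where
  from : shift c e ∈ map (shift c) es → e ∈ es
  from m with ∈-map⁻ (shift c) m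
  ... | e' , e'∈es , eq = subst (_∈ es) (sym (shift-injective c eq)) e'∈es

origin : Hex
origin = (+ 0 , + 0)

hexEdges-shift : ∀ h → hexEdges h ≡ map (shift (corner h)) (hexEdges origin)
hexEdges-shift (i , j) rewrite +-identityʳ (+ 2 * i + j) | +-identityʳ j = refl

hexVerts-shift : ∀ h → hexVerts h ≡ map (corner h ⊕_) (hexVerts origin)
hexVerts-shift (i , j) rewrite +-identityʳ (+ 2 * i + j) | +-identityʳ j = refl

∈-hexEdges⁺ : ∀ h {e} → e ∈ hexEdges origin → shift (corner h) e ∈ hexEdges h
∈-hexEdges⁺ h {e} m = subst (shift (corner h) e ∈_) (sym (hexEdges-shift h)) (∈-map⁺ (shift (corner h)) m)

∈-hexEdges⁻ : ∀ h {e} → e ∈ hexEdges h → ∃ λ e₀ → e₀ ∈ hexEdges origin × e ≡ shift (corner h) e₀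
∈-hexEdges⁻ h {e} m = ∈-map⁻ (shift (corner h)) (subst (e ∈_) (hexEdges-shift h) m)

∈-hexVerts⁺ : ∀ h {u} → u ∈ hexVerts origin → corner h ⊕ u ∈ hexVerts h
∈-hexVerts⁺ h {u} m = subst (corner h ⊕ u ∈_) (sym (hexVerts-shift h)) (∈-map⁺ (corner h ⊕_) m)

∈-hexVerts⁻ : ∀ h {v} → v ∈ hexVerts h → ∃ λ u → u ∈ hexVerts origin × v ≡ corner h ⊕ u
∈-hexVerts⁻ h {v} m = ∈-map⁻ (corner h ⊕_) (subst (v ∈_) (hexVerts-shift h) m)

kekuleₒ : Bool → List Edge
kekuleₒ true  = hor (+ 0) (+ 0) ∷ ver (+ 2) (+ 0) ∷ hor (+ 0) (+ 1) ∷ []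
kekuleₒ false = hor (+ 1) (+ 0) ∷ hor (+ 1) (+ 1) ∷ ver (+ 0) (+ 0) ∷ []

mateₒ : Bool → Vertex → Edge
mateₒ true  (+ 2 , _) = ver (+ 2) (+ 0)
mateₒ true  (_ , + 0) = hor (+ 0) (+ 0)
mateₒ true  _         = hor (+ 0) (+ 1)
mateₒ false (+ 0 , _) = ver (+ 0) (+ 0)
mateₒ false (_ , + 0) = hor (+ 1) (+ 0)
mateₒ false _         = hor (+ 1) (+ 1)

hexEdgesₒ-ends : All (BothEnds (_∈ hexVerts origin)) (hexEdges origin)
hexEdgesₒ-ends = from-yes (all? (bothEnds? (_∈ᵛ? hexVerts origin)) (hexEdges origin))

kekuleₒ⊆hexEdges : ∀ t → All (_∈ hexEdges origin) (kekuleₒ t)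
kekuleₒ⊆hexEdges true  = from-yes (all? (_∈? hexEdges origin) (kekuleₒ true))
kekuleₒ⊆hexEdges false = from-yes (all? (_∈? hexEdges origin) (kekuleₒ false))

mateₒ-covers : ∀ t → All (λ v → mateₒ t v ∈ kekuleₒ t × v ∈ᵉ mateₒ t v) (hexVerts origin)
mateₒ-covers true  = from-yes (all? (λ v → (mateₒ true v ∈? kekuleₒ true) ×-dec (v ∈ᵉ? mateₒ true v))
                                    (hexVerts origin))
mateₒ-covers false = from-yes (all? (λ v → (mateₒ false v ∈? kekuleₒ false) ×-dec (v ∈ᵉ? mateₒ false v))
                                    (hexVerts origin))

mateₒ-unique : ∀ t → All (λ e → BothEnds (λ u → e ≡ mateₒ t u) e) (kekuleₒ t)
mateₒ-unique true  = from-yes (all? (λ e → bothEnds? (λ u → e ≟ᵉ mateₒ true u) e) (kekuleₒ true))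
mateₒ-unique false = from-yes (all? (λ e → bothEnds? (λ u → e ≟ᵉ mateₒ false u) e) (kekuleₒ false))

kekuleₒ-mate : ∀ t {e u} → e ∈ kekuleₒ t → u ∈ᵉ e → e ≡ mateₒ t u
kekuleₒ-mate t {e} e∈ = BothEnds-∈ᵉ {e = e} (All.lookup (mateₒ-unique t) e∈)

alternation : Bool → List Bool
alternation t = t ∷ not t ∷ t ∷ not t ∷ t ∷ not t ∷ []

kekuleₒ-alternates : ∀ t → map ⟦ kekuleₒ t ⟧ (hexEdges origin) ≡ alternation t
kekuleₒ-alternates true  = refl
kekuleₒ-alternates false = refl

kekule : Bool → Hex → List Edge
kekule t h = map (shift (corner h)) (kekuleₒ t)

hexEdge-ends : ∀ h {e v} → e ∈ hexEdges h → v ∈ᵉ e → v ∈ hexVerts h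
hexEdge-ends h m v∈e with ∈-hexEdges⁻ h m
... | e₀ , e₀∈ , refl with ∈ᵉ-shift⁻ (corner h) e₀ v∈e
... | u , refl , u∈e₀ = ∈-hexVerts⁺ h (BothEnds-∈ᵉ {e = e₀} (All.lookup hexEdgesₒ-ends e₀∈) u∈e₀)

kekule⊆hexEdges : ∀ t h {e} → e ∈ kekule t h → e ∈ hexEdges h
kekule⊆hexEdges t h m with ∈-map⁻ (shift (corner h)) m
... | e₀ , e₀∈ , refl = ∈-hexEdges⁺ h (All.lookup (kekuleₒ⊆hexEdges t) e₀∈)

kekule-ends : ∀ t h {e v} → e ∈ kekule t h → v ∈ᵉ e → v ∈ hexVerts h
kekule-ends t h m = hexEdge-ends h (kekule⊆hexEdges t h m)

kekule-covers : ∀ t h {v} → v ∈ hexVerts h → ∃ λ e → e ∈ kekule t h × v ∈ᵉ e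
kekule-covers t h m with ∈-hexVerts⁻ h m
... | u , u∈ , refl with All.lookup (mateₒ-covers t) u∈
... | mate∈ , u∈mate =
  shift (corner h) (mateₒ t u) , ∈-map⁺ (shift (corner h)) mate∈ , ∈ᵉ-shift⁺ (corner h) (mateₒ t u) u∈mate

kekule-disjoint : ∀ t h {v e e'} → e ∈ kekule t h → e' ∈ kekule t h → v ∈ᵉ e → v ∈ᵉ e' → e ≡ e'
kekule-disjoint t h m m' v∈e v∈e' with ∈-map⁻ (shift (corner h)) m | ∈-map⁻ (shift (corner h)) m'
... | e₀ , e₀∈ , refl | e₀' , e₀'∈ , refl
  with ∈ᵉ-shift⁻ (corner h) e₀ v∈e | ∈ᵉ-shift⁻ (corner h) e₀' v∈e'
... | u , refl , u∈e₀ | u' , eq , u'∈e₀' with ⊕-cancelˡ (corner h) eq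
... | refl = cong (shift (corner h)) (trans (kekuleₒ-mate t e₀∈ u∈e₀) (sym (kekuleₒ-mate t e₀'∈ u'∈e₀')))

kekule-alternates : ∀ t h → map ⟦ kekule t h ⟧ (hexEdges h) ≡ alternation t
kekule-alternates t h = begin
  map ⟦ kekule t h ⟧ (hexEdges h)                 ≡⟨ cong (map ⟦ kekule t h ⟧) (hexEdges-shift h) ⟩
  map ⟦ kekule t h ⟧ (map (shift c) (hexEdges origin)) ≡⟨ map-∘ {g = ⟦ kekule t h ⟧} {shift c} (hexEdges origin) ⟨
  map (⟦ kekule t h ⟧ ∘ shift c) (hexEdges origin) ≡⟨ map-cong (⟦⟧-shift c (kekuleₒ t)) (hexEdges origin) ⟩
  map ⟦ kekuleₒ t ⟧ (hexEdges origin)             ≡⟨ kekuleₒ-alternates t ⟩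
  alternation t                                   ∎
  where
  open ≡-Reasoning
  c : Vertex
  c = corner h

Alternating⇒alternation : ∀ {M h} → Alternating M h → ∃ λ t → map M (hexEdges h) ≡ alternation t
Alternating⇒alternation (inj₁ eq) = true , eq
Alternating⇒alternation (inj₂ eq) = false , eq

alternation⇒Alternating : ∀ {M h} t → map M (hexEdges h) ≡ alternation t → Alternating M h
alternation⇒Alternating true  eq = inj₁ eq
alternation⇒Alternating false eq = inj₂ eq

firstEdge : Hex → Edge
firstEdge h = shift (corner h) (hor (+ 0) (+ 0))

firstEdge∈hexEdges : ∀ h → firstEdge h ∈ hexEdges h
firstEdge∈hexEdges h = ∈-hexEdges⁺ h (here refl)

kekule-firstEdge : ∀ t h → ⟦ kekule t h ⟧ (firstEdge h) ≡ t
kekule-firstEdge t h = trans (⟦⟧-shift (corner h) (kekuleₒ t) (hor (+ 0) (+ 0))) (kekuleₒ-first t)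
  where
  kekuleₒ-first : ∀ t → ⟦ kekuleₒ t ⟧ (hor (+ 0) (+ 0)) ≡ t
  kekuleₒ-first true  = refl
  kekuleₒ-first false = refl

Alternating⇒kekule : ∀ {M h} → Alternating M h →
                     ∀ {e} → e ∈ hexEdges h → M e ≡ ⟦ kekule (M (firstEdge h)) h ⟧ e
Alternating⇒kekule {M} {h} alt {e} e∈h with Alternating⇒alternation {M} {h} alt
... | t , eq = trans (agree e∈h) (cong (λ s → ⟦ kekule s h ⟧ e) t≡M₀)
  where
  agree : ∀ {e} → e ∈ hexEdges h → M e ≡ ⟦ kekule t h ⟧ e
  agree = ≡-on-map {f = M} {g = ⟦ kekule t h ⟧} (trans eq (sym (kekule-alternates t h)))
  t≡M₀ : t ≡ M (firstEdge h)
  t≡M₀ = sym (trans (agree (firstEdge∈hexEdges h)) (kekule-firstEdge t h))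

kekule⇒Alternating : ∀ {M} t h → (∀ {e} → e ∈ hexEdges h → M e ≡ ⟦ kekule t h ⟧ e) → Alternating M h
kekule⇒Alternating {M} t h agree =
  alternation⇒Alternating {M} {h} t (trans (map-cong-local (All.tabulate agree)) (kekule-alternates t h))

kekule-not : ∀ t h {e} → e ∈ hexEdges h → ⟦ kekule (not t) h ⟧ e ≡ not (⟦ kekule t h ⟧ e)
kekule-not t h = ≡-on-map {f = ⟦ kekule (not t) h ⟧} {g = not ∘ ⟦ kekule t h ⟧} (begin
  map ⟦ kekule (not t) h ⟧ (hexEdges h)     ≡⟨ kekule-alternates (not t) h ⟩
  map not (alternation t)                  ≡⟨ cong (map not) (kekule-alternates t h) ⟨
  map not (map ⟦ kekule t h ⟧ (hexEdges h)) ≡⟨ map-∘ {g = not} {f = ⟦ kekule t h ⟧} (hexEdges h) ⟨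
  map (not ∘ ⟦ kekule t h ⟧) (hexEdges h)   ∎)
  where open ≡-Reasoning

kekule-xor : ∀ t t' h {e} → e ∈ hexEdges h → ⟦ kekule t h ⟧ e xor ⟦ kekule t' h ⟧ e ≡ t xor t'
kekule-xor true  true  h {e} _ = xor-same (⟦ kekule true h ⟧ e)
kekule-xor false false h {e} _ = xor-same (⟦ kekule false h ⟧ e)
kekule-xor true  false h {e} e∈h rewrite kekule-not true h e∈h =
  trans (sym (not-distribʳ-xor a a)) (cong not (xor-same a))
  where
  a : Bool
  a = ⟦ kekule true h ⟧ e
kekule-xor false true  h {e} e∈h rewrite kekule-not true h e∈h =
  trans (sym (not-distribˡ-xor a a)) (cong not (xor-same a))
  where
  a : Bool
  a = ⟦ kekule true h ⟧ e

corner∈hexVerts : ∀ h → corner h ∈ hexVerts h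
corner∈hexVerts (i , j) = here refl

ver∈hexEdges : ∀ h {a b} → ver a b ∈ hexEdges h →
               b ≡ proj₂ (corner h) × (a ≡ proj₁ (corner h) ⊎ a ≡ proj₁ (corner h) + + 2)
ver∈hexEdges (i , j) (there (there (here refl)))                         = refl , inj₂ refl
ver∈hexEdges (i , j) (there (there (there (there (there (here refl)))))) = refl , inj₁ refl
ver∈hexEdges (i , j) (here ())
ver∈hexEdges (i , j) (there (here ()))
ver∈hexEdges (i , j) (there (there (there (here ()))))
ver∈hexEdges (i , j) (there (there (there (there (here ())))))
ver∈hexEdges (i , j) (there (there (there (there (there (there ()))))))

-- The vertical edges of the hexagon with corner (x , y) lie in the columns x and x + 2;
-- the columns x' and x' + 2 of a hexagon inside it fit into {x , x + 2} only if x' = x.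
hexEdges⊆⇒corner≡ : ∀ h' h → (∀ {e} → e ∈ hexEdges h' → e ∈ hexEdges h) → corner h' ≡ corner h
hexEdges⊆⇒corner≡ (i' , j') h sub
  with ver∈hexEdges h (sub (there (there (there (there (there (here refl)))))))
     | ver∈hexEdges h (sub (there (there (here refl))))
... | y'≡y , inj₁ x'≡x   | _                  = cong₂ _,_ x'≡x y'≡y
... | _    , inj₂ x'≡x+2 | _ , inj₁ x'+2≡x   =
  ⊥-elim (x+[1+n]≢x x 3 (trans (sym (+-assoc x (+ 2) (+ 2))) (trans (cong (_+ + 2) (sym x'≡x+2)) x'+2≡x)))
  where
  x : ℤ
  x = proj₁ (corner h)
... | _    , inj₂ x'≡x+2 | _ , inj₂ x'+2≡x+2 =
  ⊥-elim (x+[1+n]≢x (x + + 2) 1 (trans (cong (_+ + 2) (sym x'≡x+2)) x'+2≡x+2))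
  where
  x : ℤ
  x = proj₁ (corner h)

kekules : (hs : List Hex) → Vec Bool (length hs) → List Edge
kekules []       []       = []
kekules (h ∷ hs) (t ∷ ts) = kekule t h ++ kekules hs ts

∈-kekules⁺ : ∀ hs ts i {e} → e ∈ kekule (Vec.lookup ts i) (lookup hs i) → e ∈ kekules hs ts
∈-kekules⁺ (h ∷ hs) (t ∷ ts) zero    m = ∈-++⁺ˡ m
∈-kekules⁺ (h ∷ hs) (t ∷ ts) (suc i) m = ∈-++⁺ʳ (kekule t h) (∈-kekules⁺ hs ts i m)

∈-kekules⁻ : ∀ hs ts {e} → e ∈ kekules hs ts → ∃ λ i → e ∈ kekule (Vec.lookup ts i) (lookup hs i)
∈-kekules⁻ []       []       ()
∈-kekules⁻ (h ∷ hs) (t ∷ ts) m with ∈-++⁻ (kekule t h) m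
... | inj₁ m' = zero , m'
... | inj₂ m' = Product.map suc id (∈-kekules⁻ hs ts m')

perfectMatching : ∀ {H M} → (∀ e → M e ≡ true → IsEdge H e) →
                  (∀ v → IsVertex H v → ∃ λ e → M e ≡ true × v ∈ᵉ e) →
                  (∀ {v e e'} → M e ≡ true → M e' ≡ true → v ∈ᵉ e → v ∈ᵉ e' → e ≡ e') →
                  PerfectMatching H M
perfectMatching inH covered disjoint = record
  { inH    = inH
  ; unique = λ v vH → let (e , e∈M , v∈e) = covered v vH in
                      e , e∈M , v∈e , λ e' e'∈M v∈e' → disjoint e'∈M e∈M v∈e' v∈e
  }

matched-unique : ∀ {H M v e e'} → PerfectMatching H M → IsVertex H v →
                 M e ≡ true → M e' ≡ true → v ∈ᵉ e → v ∈ᵉ e' → e ≡ e'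
matched-unique pm vH e∈M e'∈M v∈e v∈e' with PerfectMatching.unique pm _ vH
... | _ , _ , _ , unique = trans (unique _ e∈M v∈e) (sym (unique _ e'∈M v∈e'))

edge-ends-vertex : ∀ {H e v} → IsEdge H e → v ∈ᵉ e → IsVertex H v
edge-ends-vertex (h , h∈H , e∈h) v∈e = h , h∈H , hexEdge-ends h e∈h v∈e

module _ {H : HexSystem} (C : ClarCover H) where

  hexOf : Fin (length (cHexes C)) → Hex
  hexOf = lookup (cHexes C)

  Bits : Set
  Bits = Vec Bool (length (cHexes C))

  hexOf-inH : ∀ i → IsHex H (hexOf i)
  hexOf-inH i = All.lookup (hexesInH C) (∈-lookup i)

  hexOf-vertex : ∀ i {v} → v ∈ hexVerts (hexOf i) → IsVertex H v
  hexOf-vertex i v∈ = hexOf i , hexOf-inH i , v∈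

  coverEdge-vertex : ∀ {e v} → e ∈ cEdges C → v ∈ᵉ e → IsVertex H v
  coverEdge-vertex e∈ = edge-ends-vertex {H} (All.lookup (edgesInH C) e∈)

  piece-unique : ∀ {v j j'} → IsVertex H v → v ∈ᵖ lookup (pieces C) j → v ∈ᵖ lookup (pieces C) j' → j ≡ j'
  piece-unique vH v∈j v∈j' with partition C _ vH
  ... | _ , _ , unique = trans (unique _ v∈j) (sym (unique _ v∈j'))

  hexPosition : Fin (length (cHexes C)) → Fin (length (pieces C))
  hexPosition = position hexP (cHexes C) (map edgeP (cEdges C))

  lookup-hexPosition : ∀ i → lookup (pieces C) (hexPosition i) ≡ hexP (hexOf i)
  lookup-hexPosition = lookup-position hexP (cHexes C) (map edgeP (cEdges C))

  edgePosition : ∀ {e} → e ∈ cEdges C → Fin (length (pieces C))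
  edgePosition e∈ = Any.index (∈-++⁺ʳ (map hexP (cHexes C)) (∈-map⁺ edgeP e∈))

  lookup-edgePosition : ∀ {e} (e∈ : e ∈ cEdges C) → lookup (pieces C) (edgePosition e∈) ≡ edgeP e
  lookup-edgePosition e∈ = sym (lookup-index (∈-++⁺ʳ (map hexP (cHexes C)) (∈-map⁺ edgeP e∈)))

  ∈ᵖ-hexPosition : ∀ {v} i → v ∈ hexVerts (hexOf i) → v ∈ᵖ lookup (pieces C) (hexPosition i)
  ∈ᵖ-hexPosition {v} i = subst (v ∈ᵖ_) (sym (lookup-hexPosition i))

  ∈ᵖ-edgePosition : ∀ {v e} (e∈ : e ∈ cEdges C) → v ∈ᵉ e → v ∈ᵖ lookup (pieces C) (edgePosition e∈)
  ∈ᵖ-edgePosition {v} e∈ = subst (v ∈ᵖ_) (sym (lookup-edgePosition e∈))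

  coverHexes-disjoint : ∀ {v i j} → v ∈ hexVerts (hexOf i) → v ∈ hexVerts (hexOf j) → i ≡ j
  coverHexes-disjoint {i = i} {j} v∈i v∈j =
    position-injective hexP (cHexes C) (map edgeP (cEdges C))
      (piece-unique (hexOf-vertex i v∈i) (∈ᵖ-hexPosition i v∈i) (∈ᵖ-hexPosition j v∈j))

  coverHex-coverEdge-disjoint : ∀ {v i e} → v ∈ hexVerts (hexOf i) → e ∈ cEdges C → v ∈ᵉ e → ⊥
  coverHex-coverEdge-disjoint {v} {i} {e} v∈i e∈ v∈e = hexP≢edgeP (begin
    hexP (hexOf i)                      ≡⟨ lookup-hexPosition i ⟨
    lookup (pieces C) (hexPosition i)   ≡⟨ cong (lookup (pieces C)) same-position ⟩
    lookup (pieces C) (edgePosition e∈) ≡⟨ lookup-edgePosition e∈ ⟩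
    edgeP e                             ∎)
    where
    open ≡-Reasoning
    same-position : hexPosition i ≡ edgePosition e∈
    same-position = piece-unique (hexOf-vertex i v∈i) (∈ᵖ-hexPosition i v∈i) (∈ᵖ-edgePosition e∈ v∈e)
    hexP≢edgeP : hexP (hexOf i) ≢ edgeP e
    hexP≢edgeP ()

  coverEdges-disjoint : ∀ {v e e'} → e ∈ cEdges C → e' ∈ cEdges C → v ∈ᵉ e → v ∈ᵉ e' → e ≡ e'
  coverEdges-disjoint {v} {e} {e'} e∈ e'∈ v∈e v∈e' = edgeP-injective (begin
    edgeP e                              ≡⟨ lookup-edgePosition e∈ ⟨
    lookup (pieces C) (edgePosition e∈)  ≡⟨ cong (lookup (pieces C)) same-position ⟩
    lookup (pieces C) (edgePosition e'∈) ≡⟨ lookup-edgePosition e'∈ ⟩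
    edgeP e'                             ∎)
    where
    open ≡-Reasoning
    same-position : edgePosition e∈ ≡ edgePosition e'∈
    same-position =
      piece-unique (coverEdge-vertex e∈ v∈e) (∈ᵖ-edgePosition e∈ v∈e) (∈ᵖ-edgePosition e'∈ v∈e')
    edgeP-injective : edgeP e ≡ edgeP e' → e ≡ e'
    edgeP-injective refl = refl

  coverHexes-edge-disjoint : ∀ {e i j} → e ∈ hexEdges (hexOf i) → e ∈ hexEdges (hexOf j) → i ≡ j
  coverHexes-edge-disjoint {i = i} {j} e∈i e∈j =
    coverHexes-disjoint (hexEdge-ends (hexOf i) e∈i (inj₁ refl)) (hexEdge-ends (hexOf j) e∈j (inj₁ refl))

  pieces-cover : ∀ {v} → IsVertex H v →
                 (∃ λ i → v ∈ hexVerts (hexOf i)) ⊎ (∃ λ e → e ∈ cEdges C × v ∈ᵉ e)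
  pieces-cover {v} vH with partition C v vH
  ... | j , v∈j , _ with ∈-++⁻ (map hexP (cHexes C)) (∈-lookup {xs = pieces C} j)
  ... | inj₁ j∈hexes with ∈-map⁻ hexP j∈hexes
  ...   | h , h∈ , eq =
    inj₁ (Any.index h∈ , subst (λ h → v ∈ hexVerts h) (lookup-index h∈) (subst (v ∈ᵖ_) eq v∈j))
  pieces-cover {v} vH | j , v∈j , _ | inj₂ j∈edges with ∈-map⁻ edgeP j∈edges
  ...   | e , e∈ , eq = inj₂ (e , e∈ , subst (v ∈ᵖ_) eq v∈j)

  clarEdges : Bits → List Edge
  clarEdges b = cEdges C ++ kekules (cHexes C) b

  clarMatching : Bits → EdgeSet
  clarMatching b = ⟦ clarEdges b ⟧

  ∈-clarEdges⁻ : ∀ b {e} → e ∈ clarEdges b →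
                 e ∈ cEdges C ⊎ ∃ λ i → e ∈ kekule (Vec.lookup b i) (hexOf i)
  ∈-clarEdges⁻ b m = Sum.map₂ (∈-kekules⁻ (cHexes C) b) (∈-++⁻ (cEdges C) m)

  ∈-clarEdges⁺ : ∀ b i {e} → e ∈ kekule (Vec.lookup b i) (hexOf i) → e ∈ clarEdges b
  ∈-clarEdges⁺ b i m = ∈-++⁺ʳ (cEdges C) (∈-kekules⁺ (cHexes C) b i m)

  clarEdges-inH : ∀ b {e} → e ∈ clarEdges b → IsEdge H e
  clarEdges-inH b m with ∈-clarEdges⁻ b m
  ... | inj₁ e∈       = All.lookup (edgesInH C) e∈
  ... | inj₂ (i , m') = hexOf i , hexOf-inH i , kekule⊆hexEdges _ (hexOf i) m'

  clarEdges-cover : ∀ b {v} → IsVertex H v → ∃ λ e → e ∈ clarEdges b × v ∈ᵉ e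
  clarEdges-cover b vH with pieces-cover vH
  ... | inj₁ (i , v∈i) with kekule-covers (Vec.lookup b i) (hexOf i) v∈i
  ...   | e , k , v∈e = e , ∈-clarEdges⁺ b i k , v∈e
  clarEdges-cover b vH | inj₂ (e , e∈ , v∈e) = e , ∈-++⁺ˡ e∈ , v∈e

  clarEdges-disjoint : ∀ b {v e e'} → e ∈ clarEdges b → e' ∈ clarEdges b → v ∈ᵉ e → v ∈ᵉ e' → e ≡ e'
  clarEdges-disjoint b m m' v∈e v∈e' with ∈-clarEdges⁻ b m | ∈-clarEdges⁻ b m'
  ... | inj₁ e∈      | inj₁ e'∈      = coverEdges-disjoint e∈ e'∈ v∈e v∈e'
  ... | inj₁ e∈      | inj₂ (j , k') =
    ⊥-elim (coverHex-coverEdge-disjoint (kekule-ends _ (hexOf j) k' v∈e') e∈ v∈e)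
  ... | inj₂ (i , k) | inj₁ e'∈      =
    ⊥-elim (coverHex-coverEdge-disjoint (kekule-ends _ (hexOf i) k v∈e) e'∈ v∈e')
  ... | inj₂ (i , k) | inj₂ (j , k')
    with coverHexes-disjoint (kekule-ends _ (hexOf i) k v∈e) (kekule-ends _ (hexOf j) k' v∈e')
  ... | refl = kekule-disjoint _ (hexOf i) k k' v∈e v∈e'

  clarMatching-perfect : ∀ b → PerfectMatching H (clarMatching b)
  clarMatching-perfect b = perfectMatching
    (λ e e∈M → clarEdges-inH b (⟦⟧⇒∈ e∈M))
    (λ v vH → let (e , m , v∈e) = clarEdges-cover b vH in e , ∈⇒⟦⟧ m , v∈e)
    (λ e∈M e'∈M → clarEdges-disjoint b (⟦⟧⇒∈ e∈M) (⟦⟧⇒∈ e'∈M))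

  clarMatching-on-hexagon : ∀ b i {e} → e ∈ hexEdges (hexOf i) →
                            clarMatching b e ≡ ⟦ kekule (Vec.lookup b i) (hexOf i) ⟧ e
  clarMatching-on-hexagon b i {e} e∈i = ⟦⟧-cong (mk⇔ to (∈-clarEdges⁺ b i))
    where
    to : e ∈ clarEdges b → e ∈ kekule (Vec.lookup b i) (hexOf i)
    to m with ∈-clarEdges⁻ b m
    ... | inj₁ e∈ = ⊥-elim (coverHex-coverEdge-disjoint (hexEdge-ends (hexOf i) e∈i (inj₁ refl)) e∈ (inj₁ refl))
    ... | inj₂ (j , k) with coverHexes-edge-disjoint e∈i (kekule⊆hexEdges _ (hexOf j) k)
    ...   | refl = k

  clarMatching-off-hexagons : ∀ b b' {e} → (∀ i → e ∉ hexEdges (hexOf i)) → clarMatching b e ≡ clarMatching b' e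
  clarMatching-off-hexagons b b' {e} e∉ = ⟦⟧-cong (mk⇔ (∈-++⁺ˡ ∘ coverEdge b) (∈-++⁺ˡ ∘ coverEdge b'))
    where
    coverEdge : ∀ b → e ∈ clarEdges b → e ∈ cEdges C
    coverEdge b m with ∈-clarEdges⁻ b m
    ... | inj₁ e∈      = e∈
    ... | inj₂ (i , k) = ⊥-elim (e∉ i (kekule⊆hexEdges _ (hexOf i) k))

  OnFlippedHexagon : Bits → Bits → Edge → Set
  OnFlippedHexagon b b' e = ∃ λ i → e ∈ hexEdges (hexOf i) × Vec.lookup b i ≢ Vec.lookup b' i

  clarMatching-xor : ∀ b b' e → (clarMatching b e xor clarMatching b' e ≡ true) ⇔ OnFlippedHexagon b b' e
  clarMatching-xor b b' e with Fin.any? (λ i → e ∈? hexEdges (hexOf i))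
  ... | yes (i , e∈i) = mk⇔ to from
    where
    xor≡ : clarMatching b e xor clarMatching b' e ≡ Vec.lookup b i xor Vec.lookup b' i
    xor≡ = trans (cong₂ _xor_ (clarMatching-on-hexagon b i e∈i) (clarMatching-on-hexagon b' i e∈i))
                 (kekule-xor (Vec.lookup b i) (Vec.lookup b' i) (hexOf i) e∈i)
    to : clarMatching b e xor clarMatching b' e ≡ true → OnFlippedHexagon b b' e
    to x = i , e∈i , Equivalence.to (xor≡true⇔≢ _ _) (trans (sym xor≡) x)
    from : OnFlippedHexagon b b' e → clarMatching b e xor clarMatching b' e ≡ true
    from (j , e∈j , bj≢b'j) with coverHexes-edge-disjoint e∈i e∈j
    ... | refl = trans xor≡ (Equivalence.from (xor≡true⇔≢ _ _) bj≢b'j)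
  ... | no e∉ = mk⇔ (λ x → case trans (sym xor≡false) x of λ ()) (λ (i , e∈i , _) → ⊥-elim (e∉ (i , e∈i)))
    where
    xor≡false : clarMatching b e xor clarMatching b' e ≡ false
    xor≡false = trans (cong (clarMatching b e xor_) (sym (clarMatching-off-hexagons b b' (λ i e∈i → e∉ (i , e∈i)))))
                      (xor-same (clarMatching b e))

  clarMatching-InF : ∀ b → InF H C (clarMatching b)
  clarMatching-InF b = clarMatching-perfect b , All.tabulate alternating , All.tabulate (∈⇒⟦⟧ ∘ ∈-++⁺ˡ)
    where
    alternating : ∀ {h} → h ∈ cHexes C → Alternating (clarMatching b) h
    alternating h∈ rewrite lookup-index h∈ =
      kekule⇒Alternating (Vec.lookup b i) (hexOf i) (clarMatching-on-hexagon b i)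
      where
      i : Fin (length (cHexes C))
      i = Any.index h∈

  bitsOf : EdgeSet → Bits
  bitsOf M = Vec.tabulate (λ i → M (firstEdge (hexOf i)))

  bitsOf-clarMatching : ∀ b → bitsOf (clarMatching b) ≡ b
  bitsOf-clarMatching b = trans (Vec.tabulate-cong bit) (Vec.tabulate∘lookup b)
    where
    bit : ∀ i → clarMatching b (firstEdge (hexOf i)) ≡ Vec.lookup b i
    bit i = trans (clarMatching-on-hexagon b i (firstEdge∈hexEdges (hexOf i))) (kekule-firstEdge _ (hexOf i))

  clarMatching-injective : ∀ b b' → clarMatching b ≈ₘ clarMatching b' → b ≡ b'
  clarMatching-injective b b' M≈M' = begin
    b                           ≡⟨ bitsOf-clarMatching b ⟨
    bitsOf (clarMatching b)     ≡⟨ Vec.tabulate-cong (λ i → M≈M' (firstEdge (hexOf i))) ⟩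
    bitsOf (clarMatching b')    ≡⟨ bitsOf-clarMatching b' ⟩
    b'                          ∎
    where open ≡-Reasoning

  clarMatching-bitsOf : ∀ M → InF H C M → clarMatching (bitsOf M) ≈ₘ M
  clarMatching-bitsOf M (pm , alts , coverEdges∈M) e = ⇔→≡ (mk⇔ ⊆M M⊆)
    where
    b : Bits
    b = bitsOf M
    agree : ∀ i {e} → e ∈ hexEdges (hexOf i) → M e ≡ ⟦ kekule (Vec.lookup b i) (hexOf i) ⟧ e
    agree i {e} e∈i = trans (Alternating⇒kekule {M} {hexOf i} (All.lookup alts (∈-lookup i)) e∈i)
                            (cong (λ t → ⟦ kekule t (hexOf i) ⟧ e) (sym (Vec.lookup∘tabulate _ i)))
    ⊆M : ∀ {e} → clarMatching b e ≡ true → M e ≡ true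
    ⊆M e∈ with ∈-clarEdges⁻ b (⟦⟧⇒∈ e∈)
    ... | inj₁ e∈C     = All.lookup coverEdges∈M e∈C
    ... | inj₂ (i , k) = trans (agree i (kekule⊆hexEdges _ (hexOf i) k)) (∈⇒⟦⟧ k)
    M⊆ : M e ≡ true → clarMatching b e ≡ true
    M⊆ e∈M = matched (clarEdges-cover b src∈H)
      where
      src∈H : IsVertex H (proj₁ (ends e))
      src∈H = edge-ends-vertex {H} (PerfectMatching.inH pm e e∈M) (inj₁ refl)
      matched : (∃ λ e' → e' ∈ clarEdges b × proj₁ (ends e) ∈ᵉ e') → clarMatching b e ≡ true
      matched (e' , e'∈ , v∈e')
        rewrite matched-unique pm src∈H e∈M (⊆M (∈⇒⟦⟧ e'∈)) (inj₁ refl) v∈e' = ∈⇒⟦⟧ e'∈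

  coverHexes-corner-injective : ∀ {i j} → corner (hexOf i) ≡ corner (hexOf j) → i ≡ j
  coverHexes-corner-injective {i} {j} eq =
    coverHexes-disjoint (corner∈hexVerts (hexOf i)) (subst (_∈ hexVerts (hexOf j)) (sym eq) (corner∈hexVerts (hexOf j)))

  clarMatching-adjacent : ∀ b b' → QAdj b b' ⇔ ResAdj H (clarMatching b) (clarMatching b')
  clarMatching-adjacent b b' = mk⇔ to from
    where
    to : QAdj b b' → ResAdj H (clarMatching b) (clarMatching b')
    to (i , bi≢b'i , others-same) = hexOf i , hexOf-inH i , λ e →
      mk⇔ (only-i e) (λ e∈i → Equivalence.from (clarMatching-xor b b' e) (i , e∈i , bi≢b'i))
      where
      only-i : ∀ e → clarMatching b e xor clarMatching b' e ≡ true → e ∈ hexEdges (hexOf i)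
      only-i e x with Equivalence.to (clarMatching-xor b b' e) x
      ... | j , e∈j , bj≢b'j with j Fin.≟ i
      ...   | yes refl = e∈j
      ...   | no j≢i   = ⊥-elim (bj≢b'j (others-same j j≢i))

    from : ResAdj H (clarMatching b) (clarMatching b') → QAdj b b'
    from (h , _ , flips⇔h)
      with Equivalence.to (clarMatching-xor b b' (firstEdge h)) (Equivalence.from (flips⇔h _) (firstEdge∈hexEdges h))
    ... | i , _ , bi≢b'i = i , bi≢b'i , others-same
      where
      flipped-corner : ∀ {k} → Vec.lookup b k ≢ Vec.lookup b' k → corner (hexOf k) ≡ corner h
      flipped-corner {k} bk≢b'k = hexEdges⊆⇒corner≡ (hexOf k) h λ e∈k →
        Equivalence.to (flips⇔h _) (Equivalence.from (clarMatching-xor b b' _) (k , e∈k , bk≢b'k))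
      others-same : ∀ k → k ≢ i → Vec.lookup b k ≡ Vec.lookup b' k
      others-same k k≢i with Vec.lookup b k Bool.≟ Vec.lookup b' k
      ... | yes bk≡b'k = bk≡b'k
      ... | no  bk≢b'k =
        ⊥-elim (k≢i (coverHexes-corner-injective (trans (flipped-corner bk≢b'k) (sym (flipped-corner bi≢b'i)))))

lemma1 : (H : HexSystem) → Kekulean H → (n : ℕ) → (C : ClarCover H) →
         length (cHexes C) ≡ n → FIsoQ H C n
lemma1 H _ _ C refl =
  clarMatching C , clarMatching-InF C , clarMatching-injective C ,
  (λ M M∈f → bitsOf C M , clarMatching-bitsOf C M M∈f) , clarMatching-adjacent C
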